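{- Let $n\ge1$, $k\ge2$. In any play $s_0,s_1,\dots$ of the infinite $(n,k)$-shift-game in which Alice applies $A_{tail}$, Bob applies a strategy $B$, and Alice loses, there are infinitely many indices $t$ with $B(s_t)=1$.
   Context: $[k]=\{0,\dots,k-1\}$; words written by concatenation. A strategy for Bob is $B\colon[k]^n\to\{0,1\}$ with $B(x(k-1))=0$ for all $x\in[k]^{n-1}$; a strategy for Alice is $A\colon[k]^n\to\{0,1\}$ with $A(x0)=0$ for all $x$. The infinite $(n,k)$-shift-game: a play is a (finite or infinite) sequence $s_0,s_1,\dots$ with $s_0=0^n$ and, if $s_t=x\sigma$, then $s_{t+1}=(\sigma+1)x$ if $B(s_t)=1$; $s_{t+1}=0x$ if $B(s_t)=0$ and $A(s_t)=1$; $s_{t+1}=\sigma x$ otherwise; the play stops only at the first $m>0$ with $s_m=0^n$ (Alice then wins); if this never happens the play is infinite and Bob wins (Alice loses). For $s=\sigma_0\cdots\sigma_{n-1}\in[k]^n$ and $0\le m<n$: $val(s,m)=\sum_{i=1}^n \sigma_{(m-i)\bmod n}k^{i-1}$; $head(s)=\min\{m : val(s,m)=\max_{m'} val(s,m')\}$; for $s\ne0^n$, $tail(s)=\big(\max\{i\in\mathbb{Z} : i<head(s),\ \sigma_{i\bmod n}\ne0\}\big)\bmod n$. $A_{tail}(s)=1$ if $s\ne0^n$ and $tail(s)=n-1$, and $A_{tail}(s)=0$ otherwise. -}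

module Defs where

open import Data.Nat using (ℕ; zero; suc; _+_; _*_; _∸_; _^_; _≤_; _<_; _<?_; _≟_)
open import Data.Nat.DivMod using (_%_; m%n<n)
open import Data.Fin using (Fin; toℕ; fromℕ<)
open import Data.Vec using (Vec; []; _∷_; _∷ʳ_; lookup; replicate; init; last)
open import Data.Bool using (Bool; true; false; _∧_; not)
open import Relation.Nullary using (yes; no)
open import Relation.Nullary.Decidable using (⌊_⌋)
open import Relation.Binary.PropositionalEquality using (_≡_)

Word : ℕ → ℕ → Set
Word n k = Vec (Fin k) n

zeroWord : ∀ n k → 2 Data.Nat.≤ k → Word n k
zeroWord n (suc (suc k)) _ = replicate n Data.Fin.zero
zeroWord n (suc zero) (Data.Nat.s≤s ())

-- letter s j = σ_(j mod n) as a natural number (n = 0 gives 0, never used)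
letter : ∀ {n k} → Word n k → ℕ → ℕ
letter {zero} s j = 0
letter {suc n} s j = toℕ (lookup s (fromℕ< (m%n<n j (suc n))))

sumFrom1 : ℕ → (ℕ → ℕ) → ℕ
sumFrom1 zero f = 0
sumFrom1 (suc c) f = sumFrom1 c f + f (suc c)

-- val(s,m) = Σ_{i=1}^n σ_{(m-i) mod n} k^(i-1)   (for m < n, (m-i) mod n = (m+n-i) mod n)
val : ∀ {n k} → Word n k → ℕ → ℕ
val {n} {k} s m = sumFrom1 n (λ i → letter s (m + n ∸ i) * k ^ (i ∸ 1))

maxUpTo : (ℕ → ℕ) → ℕ → ℕ
maxUpTo f zero = 0
maxUpTo f (suc c) = Data.Nat._⊔_ (maxUpTo f c) (f c)

maxVal : ∀ {n k} → Word n k → ℕ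
maxVal {n} s = maxUpTo (val s) n

-- least m < c with p m, searching from m = a upwards; default a + c if none
firstFrom : ℕ → ℕ → (ℕ → Bool) → ℕ
firstFrom a zero p = a
firstFrom a (suc c) p with p a
... | true = a
... | false = firstFrom (suc a) c p

head : ∀ {n k} → Word n k → ℕ
head {n} s = firstFrom 0 n (λ m → ⌊ val s m ≟ maxVal s ⌋)

-- tail(s) = (max { i ∈ ℤ : i < head(s), σ_(i mod n) ≠ 0 }) mod n.
-- Writing i = head(s) - d, the max corresponds to the least d ≥ 1 with
-- σ_((head - d) mod n) ≠ 0; for s ≠ 0^n such d exists with d ≤ n.
tailD : ∀ {n k} → Word n k → ℕ
tailD {n} s = firstFrom 1 n (λ d → not ⌊ letter s (head s + n ∸ d) ≟ 0 ⌋)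

tail : ∀ {n k} → Word n k → ℕ
tail {zero} s = 0
tail {suc n} s = (head s + suc n ∸ tailD s) % suc n

isZeroWord : ∀ {n k} → Word n k → Bool
isZeroWord [] = true
isZeroWord (x ∷ s) = ⌊ toℕ x ≟ 0 ⌋ ∧ isZeroWord s

Atail : ∀ {n k} → Word n k → Bool
Atail {n} s = not (isZeroWord s) ∧ ⌊ tail s ≟ n ∸ 1 ⌋

BobStrategy : ∀ n k → 1 ≤ n → (Word n k → Bool) → Set
BobStrategy (suc m) k _ B = ∀ (x : Word m k) (σ : Fin k) → toℕ σ ≡ k ∸ 1 → B (x ∷ʳ σ) ≡ false

-- σ + 1 in [k] (only used when σ ≠ k-1, where it is σ+1 exactly)
incr : ∀ {k} → Fin k → Fin k
incr {k} σ with suc (toℕ σ) <? k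
... | yes p = fromℕ< p
... | no _ = σ

-- the letter 0 of [k] (k ≥ 1 is witnessed by the argument)
zeroOf : ∀ {k} → Fin k → Fin k
zeroOf {suc k} _ = Data.Fin.zero

step : ∀ {n k} → (Word n k → Bool) → (Word n k → Bool) → Word n k → Word n k
step {zero} B A s = s
step {suc m} B A s with B s | A s
... | true | _ = incr (last s) ∷ init s
... | false | true = zeroOf (last s) ∷ init s
... | false | false = last s ∷ init s

{-# OPTIONS --safe #-}
-- If Bob stays silent from some time on, every move rotates the word (xσ ↦ σx), possibly
-- replacing the moved letter by 0, so the number of nonzero letters never increases. Every
-- nonzero word has a rotation on which A_tail fires against a nonzero last letter: bring a
-- maximiser of val (a peak, whose letter is nonzero because it is the leading digit) to the front
-- and keep rotating until a nonzero letter comes last; only zeros are passed over, so the peak is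
-- head and the last position is tail. Following the play towards that rotation, the count drops
-- there at the latest. A count of 0 would make the next word 0^n, so Bob must move; recursion on
-- the count turns this into a construction of Bob's next move.
module Submission where

open import Defs
open import Data.Nat
open import Data.Nat.Properties
open import Data.Nat.DivMod
open import Data.Fin as Fin using (Fin; toℕ; fromℕ<)
open import Data.Fin.Properties using (toℕ<n)
open import Data.Vec using (Vec; []; _∷_; _∷ʳ_; lookup; init; last; initLast; replicate)
open import Data.Bool using (Bool; true; false; not; _∧_)
open import Data.Product using (_×_; _,_; proj₂; ∃-syntax)
open import Data.Sum as Sum using (_⊎_; inj₁; inj₂; [_,_]′)
open import Function using (id)
open import Relation.Nullary using (Dec; ¬_; yes; no; contradiction)
open import Relation.Nullary.Decidable using (⌊_⌋; isYes≗does; dec-true; dec-false)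
open import Relation.Binary.PropositionalEquality

⌊⌋-true : ∀ {ℓ} {A : Set ℓ} (a? : Dec A) → A → ⌊ a? ⌋ ≡ true
⌊⌋-true a? a = trans (isYes≗does a?) (dec-true a? a)

⌊⌋-false : ∀ {ℓ} {A : Set ℓ} (a? : Dec A) → ¬ A → ⌊ a? ⌋ ≡ false
⌊⌋-false a? ¬a = trans (isYes≗does a?) (dec-false a? ¬a)

true-or-false : ∀ b → b ≡ true ⊎ b ≡ false
true-or-false true  = inj₁ refl
true-or-false false = inj₂ refl

entry : ∀ {c k} → Vec (Fin k) c → ℕ → ℕ
entry []      i       = 0
entry (x ∷ v) zero    = toℕ x
entry (x ∷ v) (suc i) = entry v i

lookup-fromℕ< : ∀ {c k} (v : Vec (Fin k) c) i .(i<c : i < c) →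
                toℕ (lookup v (fromℕ< i<c)) ≡ entry v i
lookup-fromℕ< (x ∷ v) zero    _   = refl
lookup-fromℕ< (x ∷ v) (suc i) i<c = lookup-fromℕ< v i (s<s⁻¹ i<c)

entry-∷ʳ-< : ∀ {c k} (v : Vec (Fin k) c) y {i} → i < c → entry (v ∷ʳ y) i ≡ entry v i
entry-∷ʳ-< (x ∷ v) y {zero}  _   = refl
entry-∷ʳ-< (x ∷ v) y {suc i} i<c = entry-∷ʳ-< v y (s<s⁻¹ i<c)

entry-∷ʳ : ∀ {c k} (v : Vec (Fin k) c) y → entry (v ∷ʳ y) c ≡ toℕ y
entry-∷ʳ []      y = refl
entry-∷ʳ (x ∷ v) y = entry-∷ʳ v y

isZeroWord⇒entry≡0 : ∀ {c k} (v : Vec (Fin k) c) → isZeroWord v ≡ true → ∀ i → entry v i ≡ 0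
isZeroWord⇒entry≡0 []      _ i = refl
isZeroWord⇒entry≡0 (x ∷ v) e i with toℕ x ≟ 0
isZeroWord⇒entry≡0 (x ∷ v) e zero    | yes x≡0 = x≡0
isZeroWord⇒entry≡0 (x ∷ v) e (suc i) | yes _   = isZeroWord⇒entry≡0 v e i
isZeroWord⇒entry≡0 (x ∷ v) () i      | no _

isNonzero : ∀ {k} → Fin k → ℕ
isNonzero Fin.zero    = 0
isNonzero (Fin.suc _) = 1

nonzeros : ∀ {c k} → Vec (Fin k) c → ℕ
nonzeros []      = 0
nonzeros (x ∷ v) = isNonzero x + nonzeros v

nonzeros-∷ʳ : ∀ {c k} (v : Vec (Fin k) c) y → nonzeros (v ∷ʳ y) ≡ nonzeros v + isNonzero y
nonzeros-∷ʳ []      y = +-identityʳ (isNonzero y)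
nonzeros-∷ʳ (x ∷ v) y = trans (cong (isNonzero x +_) (nonzeros-∷ʳ v y)) (sym (+-assoc (isNonzero x) _ _))

nonzeros≡0 : ∀ {c k} (v : Vec (Fin (suc k)) c) → nonzeros v ≡ 0 → v ≡ replicate c Fin.zero
nonzeros≡0 []               _    = refl
nonzeros≡0 (Fin.zero ∷ v)   none = cong (Fin.zero ∷_) (nonzeros≡0 v none)
nonzeros≡0 (Fin.suc _ ∷ v)  ()

nonzeros≢0⇒entry≢0 : ∀ {c k} (v : Vec (Fin k) c) → nonzeros v ≢ 0 → ∃[ i ] (i < c × entry v i ≢ 0)
nonzeros≢0⇒entry≢0 []              some = contradiction refl some
nonzeros≢0⇒entry≢0 (Fin.zero ∷ v)  some with nonzeros≢0⇒entry≢0 v some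
... | i , i<c , i≢0 = suc i , s≤s i<c , i≢0
nonzeros≢0⇒entry≢0 (Fin.suc _ ∷ v) _    = 0 , z<s , λ ()

[1+m]%n≡[1+m%n]%n : ∀ m n .{{_ : NonZero n}} → suc m % n ≡ suc (m % n) % n
[1+m]%n≡[1+m%n]%n m n = trans (cong (λ x → suc x % n) (m≡m%n+[m/n]*n m n)) ([m+kn]%n≡m%n (suc (m % n)) (m / n) n)

m%n≡p%n⇒[m+o]%n≡[p+o]%n : ∀ m p o n .{{_ : NonZero n}} → m % n ≡ p % n → (m + o) % n ≡ (p + o) % n
m%n≡p%n⇒[m+o]%n≡[p+o]%n m p o n m≡p = begin
  (m + o) % n               ≡⟨ %-distribˡ-+ m o n ⟩
  (m % n + o % n) % n       ≡⟨ cong (λ x → (x + o % n) % n) m≡p ⟩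
  (p % n + o % n) % n       ≡⟨ %-distribˡ-+ p o n ⟨
  (p + o) % n               ∎
  where open ≡-Reasoning

sumFrom1-cong : ∀ c {f g : ℕ → ℕ} → (∀ i → i ≤ c → f i ≡ g i) → sumFrom1 c f ≡ sumFrom1 c g
sumFrom1-cong zero    _   = refl
sumFrom1-cong (suc c) f≗g = cong₂ _+_ (sumFrom1-cong c (λ i i≤c → f≗g i (m≤n⇒m≤1+n i≤c))) (f≗g (suc c) ≤-refl)

sumFrom1-digits< : ∀ k c (d : ℕ → ℕ) → (∀ i → d i < k) → sumFrom1 c (λ i → d i * k ^ (i ∸ 1)) < k ^ c
sumFrom1-digits< k zero    d d<k = z<s
sumFrom1-digits< k (suc c) d d<k = begin-strict
  sumFrom1 c (λ i → d i * k ^ (i ∸ 1)) + d (suc c) * k ^ c <⟨ +-monoˡ-< _ (sumFrom1-digits< k c d d<k) ⟩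
  k ^ c + d (suc c) * k ^ c                               ≡⟨⟩
  suc (d (suc c)) * k ^ c                                 ≤⟨ *-monoˡ-≤ (k ^ c) (d<k (suc c)) ⟩
  k * k ^ c                                               ∎
  where open ≤-Reasoning

maxUpTo-upper : ∀ f c {y} → y < c → f y ≤ maxUpTo f c
maxUpTo-upper f (suc c) y<1+c with m≤n⇒m<n∨m≡n (s≤s⁻¹ y<1+c)
... | inj₁ y<c  = ≤-trans (maxUpTo-upper f c y<c) (m≤m⊔n _ _)
... | inj₂ refl = m≤n⊔m _ _

maxUpTo-least : ∀ f c {b} → (∀ y → y < c → f y ≤ b) → maxUpTo f c ≤ b
maxUpTo-least f zero    _     = z≤n
maxUpTo-least f (suc c) bound = ⊔-lub (maxUpTo-least f c (λ y y<c → bound y (m<n⇒m<1+n y<c))) (bound c ≤-refl)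

maxUpTo-attained : ∀ f c → 0 < c → ∃[ p ] (p < c × maxUpTo f c ≡ f p)
maxUpTo-attained f 1             _ = 0 , z<s , refl
maxUpTo-attained f (suc (suc c)) _ with maxUpTo-attained f (suc c) z<s | ≤-total (maxUpTo f (suc c)) (f (suc c))
... | _ , _   , _   | inj₁ ≤new = suc c , ≤-refl , m≤n⇒m⊔n≡n ≤new
... | p , p<c , max | inj₂ ≥new = p , m<n⇒m<1+n p<c , trans (m≥n⇒m⊔n≡m ≥new) max

firstFrom-≡ : ∀ c {a g} (p : ℕ → Bool) → a ≤ g → g < a + c →
              (∀ y → a ≤ y → y < g → p y ≡ false) → p g ≡ true → firstFrom a c p ≡ g
firstFrom-≡ zero    {a} p a≤g g<a+0 _ _ = contradiction (≤-trans g<a+0 (≤-trans (≤-reflexive (+-identityʳ a)) a≤g)) (n≮n _)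
firstFrom-≡ (suc c) {a} p a≤g g<a+c below at with m≤n⇒m<n∨m≡n a≤g
... | inj₂ refl rewrite at = refl
... | inj₁ a<g  rewrite below a ≤-refl a<g =
  firstFrom-≡ c p a<g (≤-trans g<a+c (≤-reflexive (+-suc a c))) (λ y a<y → below y (<⇒≤ a<y)) at

module _ {m k : ℕ} where

  private
    n : ℕ
    n = suc m

  rotate : Word n k → Word n k
  rotate w = last w ∷ init w

  rotate^ : ℕ → Word n k → Word n k
  rotate^ zero    w = w
  rotate^ (suc c) w = rotate^ c (rotate w)

  rotate^-+ : ∀ a b w → rotate^ (a + b) w ≡ rotate^ b (rotate^ a w)
  rotate^-+ zero    b w = refl
  rotate^-+ (suc a) b w = rotate^-+ a b (rotate w)

  rotate^-suc : ∀ c w → rotate^ (suc c) w ≡ rotate (rotate^ c w)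
  rotate^-suc c w = trans (cong (λ a → rotate^ a w) (+-comm 1 c)) (rotate^-+ c 1 w)

  init∷ʳlast : ∀ (w : Word n k) → w ≡ init w ∷ʳ last w
  init∷ʳlast w = proj₂ (proj₂ (initLast w))

  entry-last : ∀ (w : Word n k) → entry w m ≡ toℕ (last w)
  entry-last w = trans (cong (λ v → entry v m) (init∷ʳlast w)) (entry-∷ʳ (init w) (last w))

  letter≡entry : ∀ (w : Word n k) j → letter w j ≡ entry w (j % n)
  letter≡entry w j = lookup-fromℕ< w (j % n) (m%n<n j n)

  letter-cong : ∀ (w : Word n k) a b → a % n ≡ b % n → letter w a ≡ letter w b
  letter-cong w a b a≡b = trans (letter≡entry w a) (trans (cong (entry w) a≡b) (sym (letter≡entry w b)))

  letter-last : ∀ (w : Word n k) → letter w m ≡ toℕ (last w)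
  letter-last w = trans (letter≡entry w m) (trans (cong (entry w) (m≤n⇒m%n≡m ≤-refl)) (entry-last w))

  letter-rotate : ∀ (w : Word n k) j → letter (rotate w) (suc j) ≡ letter w j
  letter-rotate w j = begin
    letter (rotate w) (suc j)         ≡⟨ letter-cong (rotate w) (suc j) (suc (j % n)) ([1+m]%n≡[1+m%n]%n j n) ⟩
    letter (rotate w) (suc (j % n))   ≡⟨ shifted (j % n) (m%n<n j n) ⟩
    entry w (j % n)                   ≡⟨ letter≡entry w j ⟨
    letter w j                        ∎
    where
    open ≡-Reasoning
    shifted : ∀ r → r < n → letter (rotate w) (suc r) ≡ entry w r
    shifted r r<n with m≤n⇒m<n∨m≡n (s≤s⁻¹ r<n)
    ... | inj₂ refl = trans (letter-cong (rotate w) (suc m) 0 (n%n≡0 n)) (sym (entry-last w))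
    ... | inj₁ r<m  = begin
      letter (rotate w) (suc r)   ≡⟨ letter≡entry (rotate w) (suc r) ⟩
      entry (rotate w) (suc r % n) ≡⟨ cong (entry (rotate w)) (m<n⇒m%n≡m (s≤s r<m)) ⟩
      entry (init w) r            ≡⟨ entry-∷ʳ-< (init w) (last w) r<m ⟨
      entry (init w ∷ʳ last w) r  ≡⟨ cong (λ v → entry v r) (init∷ʳlast w) ⟨
      entry w r                   ∎

  val-cong : ∀ (w : Word n k) a b → a % n ≡ b % n → val w a ≡ val w b
  val-cong w a b a≡b = sumFrom1-cong n λ i i≤n → cong (_* k ^ (i ∸ 1)) (begin
    letter w (a + n ∸ i)     ≡⟨ cong (letter w) (+-∸-assoc a i≤n) ⟩
    letter w (a + (n ∸ i))   ≡⟨ letter-cong w (a + (n ∸ i)) (b + (n ∸ i)) (m%n≡p%n⇒[m+o]%n≡[p+o]%n a b (n ∸ i) n a≡b) ⟩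
    letter w (b + (n ∸ i))   ≡⟨ cong (letter w) (+-∸-assoc b i≤n) ⟨
    letter w (b + n ∸ i)     ∎)
    where open ≡-Reasoning

  val-rotate : ∀ (w : Word n k) j → val (rotate w) (suc j) ≡ val w j
  val-rotate w j = sumFrom1-cong n λ i i≤n → cong (_* k ^ (i ∸ 1))
    (trans (cong (letter (rotate w)) (+-∸-assoc 1 (≤-trans i≤n (m≤n+m n j)))) (letter-rotate w (j + n ∸ i)))

  -- letter w j is the leading digit of the base-k numeral val w j.
  val-<-leading : ∀ (w : Word n k) {x y} → letter w x ≡ 0 → letter w y ≢ 0 → val w x < val w y
  val-<-leading w {x} {y} x≡0 y≢0 = <-≤-trans (val<k^m x x≡0) (k^m≤val y y≢0)
    where
    lower : ℕ → ℕ
    lower j = sumFrom1 m (λ i → letter w (j + n ∸ i) * k ^ (i ∸ 1))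
    val≡ : ∀ j → val w j ≡ lower j + letter w j * k ^ m
    val≡ j = cong (λ z → lower j + letter w z * k ^ m) (m+n∸n≡m j n)
    val<k^m : ∀ j → letter w j ≡ 0 → val w j < k ^ m
    val<k^m j j≡0 rewrite val≡ j | j≡0 | +-identityʳ (lower j) =
      sumFrom1-digits< k m (λ i → letter w (j + n ∸ i)) (λ i → toℕ<n _)
    k^m≤val : ∀ j → letter w j ≢ 0 → k ^ m ≤ val w j
    k^m≤val j j≢0 rewrite val≡ j with letter w j
    ... | zero  = contradiction refl j≢0
    ... | suc d = ≤-trans (m≤m+n (k ^ m) (d * k ^ m)) (m≤n+m _ (lower j))

  record Peak (w : Word n k) (g : ℕ) : Set where
    constructor mkPeak
    field
      maximal   : ∀ y → val w y ≤ val w g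
      leading≢0 : letter w g ≢ 0

  peak-cong : ∀ (w : Word n k) a b → a % n ≡ b % n → Peak w a → Peak w b
  peak-cong w a b a≡b (mkPeak maximal a≢0) =
    mkPeak (λ y → ≤-trans (maximal y) (≤-reflexive (val-cong w a b a≡b))) λ b≡0 → a≢0 (trans (letter-cong w a b a≡b) b≡0)

  peak-rotate : ∀ (w : Word n k) {g} → Peak w g → Peak (rotate w) (suc g)
  peak-rotate w {g} (mkPeak maximal g≢0) = mkPeak maximal′ λ e → g≢0 (trans (sym (letter-rotate w g)) e)
    where
    maximal′ : ∀ y → val (rotate w) y ≤ val (rotate w) (suc g)
    maximal′ zero rewrite val-cong (rotate w) 0 n (sym (n%n≡0 n)) | val-rotate w m | val-rotate w g = maximal m
    maximal′ (suc y) rewrite val-rotate w y | val-rotate w g = maximal y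

  peak-rotate^ : ∀ c {w g} → Peak w g → Peak (rotate^ c w) (c + g)
  peak-rotate^ zero    peak = peak
  peak-rotate^ (suc c) {w} {g} peak = subst (Peak (rotate^ c (rotate w))) (+-suc c g) (peak-rotate^ c (peak-rotate w peak))

  peak-exists : ∀ (w : Word n k) x → letter w x ≢ 0 → ∃[ p ] (p < n × Peak w p)
  peak-exists w x x≢0 with maxUpTo-attained (val w) n z<s
  ... | p , p<n , max≡ = p , p<n , mkPeak maximal p≢0
    where
    maximal : ∀ y → val w y ≤ val w p
    maximal y = begin
      val w y               ≡⟨ val-cong w y (y % n) (sym (m%n%n≡m%n y n)) ⟩
      val w (y % n)         ≤⟨ maxUpTo-upper (val w) n (m%n<n y n) ⟩
      maxUpTo (val w) n     ≡⟨ max≡ ⟩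
      val w p               ∎
      where open ≤-Reasoning
    p≢0 : letter w p ≢ 0
    p≢0 p≡0 = <⇒≱ (val-<-leading w p≡0 x≢0) (maximal x)

  ZerosBelow : Word n k → ℕ → Set
  ZerosBelow w g = ∀ y → y < g → letter w y ≡ 0

  zerosBelow-rotate : ∀ (w : Word n k) {g} → letter w m ≡ 0 → ZerosBelow w g → ZerosBelow (rotate w) (suc g)
  zerosBelow-rotate w m≡0 zeros zero    _     = trans (sym (letter-last w)) m≡0
  zerosBelow-rotate w m≡0 zeros (suc y) y<1+g = trans (letter-rotate w y) (zeros y (s<s⁻¹ y<1+g))

  head-peak : ∀ (w : Word n k) {g} → g < n → Peak w g → ZerosBelow w g → head w ≡ g
  head-peak w {g} g<n (mkPeak maximal g≢0) zeros = firstFrom-≡ n (λ y → ⌊ val w y ≟ maxVal w ⌋) z≤n g<n below at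
    where
    max≡ : maxVal w ≡ val w g
    max≡ = ≤-antisym (maxUpTo-least (val w) n (λ y _ → maximal y)) (maxUpTo-upper (val w) n g<n)
    below : ∀ y → 0 ≤ y → y < g → ⌊ val w y ≟ maxVal w ⌋ ≡ false
    below y _ y<g = ⌊⌋-false (val w y ≟ maxVal w) λ y≡max →
      <-irrefl (trans y≡max max≡) (val-<-leading w (zeros y y<g) g≢0)
    at : ⌊ val w g ≟ maxVal w ⌋ ≡ true
    at = ⌊⌋-true (val w g ≟ maxVal w) (sym max≡)

  g+n∸1+g≡m : ∀ g → g + n ∸ suc g ≡ m
  g+n∸1+g≡m g = trans (cong (_∸ suc g) (+-suc g m)) (m+n∸m≡n g m)

  tailD-peak : ∀ (w : Word n k) {g} → g < n → head w ≡ g → ZerosBelow w g → letter w m ≢ 0 → tailD w ≡ suc g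
  tailD-peak w {g} g<n head≡g zeros m≢0 rewrite head≡g =
    firstFrom-≡ n (λ d → not ⌊ letter w (g + n ∸ d) ≟ 0 ⌋) (s≤s z≤n) (s≤s g<n) below at
    where
    below : ∀ d → 1 ≤ d → d < suc g → not ⌊ letter w (g + n ∸ d) ≟ 0 ⌋ ≡ false
    below d 1≤d d<1+g = cong not (⌊⌋-true (letter w (g + n ∸ d) ≟ 0) (begin
      letter w (g + n ∸ d)   ≡⟨ cong (letter w) (+-∸-comm n (s≤s⁻¹ d<1+g)) ⟩
      letter w (g ∸ d + n)   ≡⟨ letter-cong w (g ∸ d + n) (g ∸ d) ([m+n]%n≡m%n (g ∸ d) n) ⟩
      letter w (g ∸ d)       ≡⟨ zeros (g ∸ d) (∸-monoʳ-< 1≤d (s≤s⁻¹ d<1+g)) ⟩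
      0                      ∎))
      where open ≡-Reasoning
    at : not ⌊ letter w (g + n ∸ suc g) ≟ 0 ⌋ ≡ true
    at = cong not (⌊⌋-false (letter w (g + n ∸ suc g) ≟ 0) λ e → m≢0 (trans (cong (letter w) (sym (g+n∸1+g≡m g))) e))

  tail-peak : ∀ (w : Word n k) {g} → g < n → Peak w g → ZerosBelow w g → letter w m ≢ 0 → tail w ≡ m
  tail-peak w {g} g<n peak zeros m≢0 = begin
    (head w + n ∸ tailD w) % n   ≡⟨ cong₂ (λ h d → (h + n ∸ d) % n) head≡g (tailD-peak w g<n head≡g zeros m≢0) ⟩
    (g + n ∸ suc g) % n          ≡⟨ cong (_% n) (g+n∸1+g≡m g) ⟩
    m % n                        ≡⟨ m≤n⇒m%n≡m ≤-refl ⟩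
    m                            ∎
    where
    open ≡-Reasoning
    head≡g : head w ≡ g
    head≡g = head-peak w g<n peak zeros

  letter≢0⇒isZeroWord≡false : ∀ (w : Word n k) j → letter w j ≢ 0 → isZeroWord w ≡ false
  letter≢0⇒isZeroWord≡false w j j≢0 with isZeroWord w in zero?
  ... | false = refl
  ... | true  = contradiction (trans (letter≡entry w j) (isZeroWord⇒entry≡0 w zero? (j % n))) j≢0

  Atail-peak : ∀ (w : Word n k) {g} → g < n → Peak w g → ZerosBelow w g → letter w m ≢ 0 → Atail w ≡ true
  Atail-peak w g<n peak zeros m≢0 =
    trans (cong₂ (λ zero? j → not zero? ∧ ⌊ j ≟ m ⌋) (letter≢0⇒isZeroWord≡false w m m≢0) (tail-peak w g<n peak zeros m≢0))
          (⌊⌋-true (m ≟ m) refl)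

  record Erasable (w : Word n k) : Set where
    constructor mkErasable
    field
      tail-move : Atail w ≡ true
      last≢0    : toℕ (last w) ≢ 0

  -- f counts the rotations left before the peak itself comes last, where its letter is nonzero.
  erasable-from-peak : ∀ f {w g} → g + f ≡ m → Peak w g → ZerosBelow w g → ∃[ c ] Erasable (rotate^ c w)
  erasable-from-peak f {w} {g} g+f≡m peak zeros with letter w m ≟ 0
  ... | no m≢0 = 0 , mkErasable (Atail-peak w (s≤s (subst (g ≤_) g+f≡m (m≤m+n g f))) peak zeros m≢0)
                     λ last≡0 → m≢0 (trans (letter-last w) last≡0)
  erasable-from-peak zero    {w} {g} g+0≡m peak _ | yes m≡0 =
    contradiction (trans (cong (letter w) (trans (sym (+-identityʳ g)) g+0≡m)) m≡0) (Peak.leading≢0 peak)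
  erasable-from-peak (suc f) {w} {g} g+f≡m peak zeros | yes m≡0
    with erasable-from-peak f (trans (sym (+-suc g f)) g+f≡m) (peak-rotate w peak) (zerosBelow-rotate w m≡0 zeros)
  ... | c , ready = suc c , ready

  peak-at-front : ∀ (w : Word n k) x → letter w x ≢ 0 → ∃[ c ] Peak (rotate^ c w) 0
  peak-at-front w x x≢0 with peak-exists w x x≢0
  ... | p , p<n , peak = n ∸ p , peak-cong (rotate^ (n ∸ p) w) (n ∸ p + p) 0 to-front (peak-rotate^ (n ∸ p) peak)
    where
    to-front : (n ∸ p + p) % n ≡ 0
    to-front = trans (cong (_% n) (m∸n+n≡m (<⇒≤ p<n))) (n%n≡0 n)

  erasable-rotation : ∀ (w : Word n k) x → letter w x ≢ 0 → ∃[ c ] Erasable (rotate^ c w)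
  erasable-rotation w x x≢0 with peak-at-front w x x≢0
  ... | c , peak with erasable-from-peak m refl peak (λ _ ())
  ...   | c′ , ready = c + c′ , subst Erasable (sym (rotate^-+ c c′ w)) ready

  nonzeros≢0⇒letter≢0 : ∀ (w : Word n k) → nonzeros w ≢ 0 → ∃[ x ] letter w x ≢ 0
  nonzeros≢0⇒letter≢0 w some with nonzeros≢0⇒entry≢0 w some
  ... | i , i<n , i≢0 = i , λ i≡0 → i≢0 (trans (cong (entry w) (sym (m<n⇒m%n≡m i<n))) (trans (sym (letter≡entry w i)) i≡0))

  nonzeros-rotate : ∀ (w : Word n k) → nonzeros (rotate w) ≡ nonzeros w
  nonzeros-rotate w = begin
    isNonzero (last w) + nonzeros (init w)   ≡⟨ +-comm (isNonzero (last w)) _ ⟩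
    nonzeros (init w) + isNonzero (last w)   ≡⟨ nonzeros-∷ʳ (init w) (last w) ⟨
    nonzeros (init w ∷ʳ last w)              ≡⟨ cong nonzeros (init∷ʳlast w) ⟨
    nonzeros w                               ∎
    where open ≡-Reasoning

  nonzeros-rotate^ : ∀ c (w : Word n k) → nonzeros (rotate^ c w) ≡ nonzeros w
  nonzeros-rotate^ zero    w = refl
  nonzeros-rotate^ (suc c) w = trans (nonzeros-rotate^ c (rotate w)) (nonzeros-rotate w)

  erase : Word n k → Word n k
  erase w = zeroOf (last w) ∷ init w

  erase-fewer : ∀ (w : Word n k) → toℕ (last w) ≢ 0 → nonzeros (erase w) < nonzeros w
  erase-fewer w last≢0 with last w | trans (cong nonzeros (init∷ʳlast w)) (nonzeros-∷ʳ (init w) (last w))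
  ... | Fin.zero  | _   = contradiction refl last≢0
  ... | Fin.suc _ | w≡  = ≤-reflexive (trans (+-comm 1 _) (sym w≡))

  erase-rotate : ∀ (w : Word n k) → toℕ (last w) ≡ 0 → erase w ≡ rotate w
  erase-rotate w last≡0 with last w
  erase-rotate w _  | Fin.zero  = refl
  erase-rotate w () | Fin.suc _

  step-erase : ∀ B A (w : Word n k) → B w ≡ false → A w ≡ true → step B A w ≡ erase w
  step-erase B A w b a rewrite b | a = refl

  step-rotate : ∀ B A (w : Word n k) → B w ≡ false → A w ≡ false → step B A w ≡ rotate w
  step-rotate B A w b a rewrite b | a = refl

  silent-step : ∀ B A (w : Word n k) → B w ≡ false → nonzeros (step B A w) < nonzeros w ⊎ step B A w ≡ rotate w
  silent-step B A w b = by-move (A w) refl (toℕ (last w) ≟ 0)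
    where
    by-move : ∀ alice → A w ≡ alice → Dec (toℕ (last w) ≡ 0) →
              nonzeros (step B A w) < nonzeros w ⊎ step B A w ≡ rotate w
    by-move false a _            = inj₂ (step-rotate B A w b a)
    by-move true  a (yes last≡0) = inj₂ (trans (step-erase B A w b a) (erase-rotate w last≡0))
    by-move true  a (no last≢0)  =
      inj₁ (subst (λ v → nonzeros v < nonzeros w) (sym (step-erase B A w b a)) (erase-fewer w last≢0))

  silent-step-≤ : ∀ B A (w : Word n k) → B w ≡ false → nonzeros (step B A w) ≤ nonzeros w
  silent-step-≤ B A w b with silent-step B A w b
  ... | inj₁ fewer   = <⇒≤ fewer
  ... | inj₂ rotated = ≤-reflexive (trans (cong nonzeros rotated) (nonzeros-rotate w))

  erasing-step : ∀ B (w : Word n k) → B w ≡ false → Erasable w → nonzeros (step B Atail w) < nonzeros w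
  erasing-step B w b (mkErasable atail last≢0) =
    subst (λ v → nonzeros v < nonzeros w) (sym (step-erase B Atail w b atail)) (erase-fewer w last≢0)

module Play {m k : ℕ}
  (B : Word (suc m) (2 + k) → Bool)
  (s : ℕ → Word (suc m) (2 + k))
  (s-step : ∀ t → s (suc t) ≡ step B Atail (s t))
  (never-zero : ∀ t → 0 < t → s t ≢ zeroWord (suc m) (2 + k) (s≤s (s≤s z≤n)))
  where

  Answer : ℕ → Set
  Answer t = ∃[ u ] (t ≤ u × B (s u) ≡ true)

  Progress : ℕ → Set
  Progress t = Answer t ⊎ ∃[ u ] (t < u × nonzeros (s u) < nonzeros (s t))

  -- Case splits on Bob's move avoid `with`: abstracting B (s u) makes Agda normalise Atail in the
  -- types of the module parameters, which exhausts memory.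
  by-bob : ∀ u {P : Set} → (B (s u) ≡ true → P) → (B (s u) ≡ false → P) → P
  by-bob u moves silent = [ moves , silent ]′ (true-or-false (B (s u)))

  fewer-after-rotations : ∀ t i → s (t + i) ≡ rotate^ i (s t) →
    nonzeros (step B Atail (s (t + i))) < nonzeros (s (t + i)) → Progress t
  fewer-after-rotations t i rotated fewer = inj₂ (suc (t + i) , s≤s (m≤m+n t i) , (begin-strict
    nonzeros (s (suc (t + i)))            ≡⟨ cong nonzeros (s-step (t + i)) ⟩
    nonzeros (step B Atail (s (t + i)))   <⟨ fewer ⟩
    nonzeros (s (t + i))                  ≡⟨ cong nonzeros rotated ⟩
    nonzeros (rotate^ i (s t))            ≡⟨ nonzeros-rotate^ i (s t) ⟩
    nonzeros (s t)                        ∎))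
    where open ≤-Reasoning

  rotates-or-progress : ∀ t i → Progress t ⊎ s (t + i) ≡ rotate^ i (s t)
  rotates-or-progress t zero    = inj₂ (cong s (+-identityʳ t))
  rotates-or-progress t (suc i) = [ inj₁ , one-more ]′ (rotates-or-progress t i)
    where
    one-more : s (t + i) ≡ rotate^ i (s t) → Progress t ⊎ s (t + suc i) ≡ rotate^ (suc i) (s t)
    one-more rotated = by-bob (t + i) (λ b → inj₁ (inj₁ (t + i , m≤m+n t i , b))) λ b →
      Sum.map (fewer-after-rotations t i rotated) rotate-once (silent-step B Atail (s (t + i)) b)
      where
      rotate-once : step B Atail (s (t + i)) ≡ rotate (s (t + i)) → s (t + suc i) ≡ rotate^ (suc i) (s t)
      rotate-once rotate-step = begin
        s (t + suc i)                  ≡⟨ cong s (+-suc t i) ⟩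
        s (suc (t + i))                ≡⟨ s-step (t + i) ⟩
        step B Atail (s (t + i))       ≡⟨ rotate-step ⟩
        rotate (s (t + i))             ≡⟨ cong rotate rotated ⟩
        rotate (rotate^ i (s t))       ≡⟨ rotate^-suc i (s t) ⟨
        rotate^ (suc i) (s t)          ∎
        where open ≡-Reasoning

  progress-erasable : ∀ t c → Erasable (rotate^ c (s t)) → Progress t
  progress-erasable t c ready = [ id , erase-at ]′ (rotates-or-progress t c)
    where
    erase-at : s (t + c) ≡ rotate^ c (s t) → Progress t
    erase-at rotated = by-bob (t + c) (λ b → inj₁ (t + c , m≤m+n t c , b)) λ b →
      fewer-after-rotations t c rotated (erasing-step B (s (t + c)) b (subst Erasable (sym rotated) ready))

  answer-all-zero : ∀ t → nonzeros (s t) ≡ 0 → Answer t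
  answer-all-zero t none = by-bob t (λ b → t , ≤-refl , b) λ b →
    contradiction (nonzeros≡0 (s (suc t)) (n≤0⇒n≡0 (next≤0 b))) (never-zero (suc t) z<s)
    where
    next≤0 : B (s t) ≡ false → nonzeros (s (suc t)) ≤ 0
    next≤0 b = subst₂ (λ v c → nonzeros v ≤ c) (sym (s-step t)) none (silent-step-≤ B Atail (s t) b)

  progress : ∀ t → Progress t
  progress t = by-count (nonzeros (s t) ≟ 0)
    where
    by-count : Dec (nonzeros (s t) ≡ 0) → Progress t
    by-count (yes none) = inj₁ (answer-all-zero t none)
    by-count (no some)  =
      let x , x≢0 = nonzeros≢0⇒letter≢0 (s t) some
          c , ready = erasable-rotation (s t) x x≢0
      in progress-erasable t c ready

  answer : ∀ c t → nonzeros (s t) < c → Answer t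
  answer zero    t ()
  answer (suc c) t bound = [ id , later ]′ (progress t)
    where
    later : ∃[ u ] (t < u × nonzeros (s u) < nonzeros (s t)) → Answer t
    later (u , t<u , fewer) =
      let v , u≤v , bob = answer c u (<-≤-trans fewer (s≤s⁻¹ bound))
      in v , ≤-trans (<⇒≤ t<u) u≤v , bob

claim29 : (n k : ℕ) (n≥1 : 1 ≤ n) (k≥2 : 2 ≤ k)
          (B : Word n k → Bool) → BobStrategy n k n≥1 B →
          (s : ℕ → Word n k) →
          s 0 ≡ zeroWord n k k≥2 →
          (∀ t → s (suc t) ≡ step B Atail (s t)) →
          (∀ m → 0 < m → s m ≢ zeroWord n k k≥2) →
          ∀ N → ∃[ t ] (N ≤ t × B (s t) ≡ true)
claim29 (suc m) (suc (suc k)) (s≤s z≤n) (s≤s (s≤s z≤n)) B _ s _ s-step never-zero N =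
  Play.answer B s s-step never-zero (suc (nonzeros (s N))) N ≤-refl
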